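{- For all integers $n,k$ with $n\equiv 1\pmod 4$, $k\equiv 1\pmod 4$ and $5\leq k<n$, there exists a Heffter array $H(n;k)$.
   Context: A Heffter array $H(n;k)$ is an $n\times n$ array, some of whose cells are filled with integers, such that: each row and each column contains exactly $k$ filled cells; every row sum and column sum is congruent to $0$ modulo $2nk+1$; and for each integer $1\leq x\leq nk$, either $x$ or $-x$ appears in the array. -}

module Defs where

open import Data.Nat using (ℕ; suc; _*_; _+_)
open import Data.Fin using (Fin)
open import Data.Maybe using (Maybe; just; nothing; is-just)
open import Data.Bool using (if_then_else_)
open import Data.Integer as ℤ using (ℤ; +_)
open import Data.Integer.Divisibility using (_∣_)
open import Data.Product using (Σ; ∃; _×_; _,_)
open import Data.Sum using (_⊎_)
open import Data.List using (List; length; filter; map; foldr)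
open import Data.List.Base using (allFin)
open import Relation.Binary.PropositionalEquality using (_≡_)
open import Relation.Unary using (Pred)
open import Data.Maybe.Relation.Unary.Any as MAny using ()
open import Data.Bool using (Bool; true; false)

-- A partially filled n×n array of integers: nothing = empty cell.
PartialArray : ℕ → Set
PartialArray n = Fin n → Fin n → Maybe ℤ

filledCount : ∀ {n} → (Fin n → Maybe ℤ) → ℕ
filledCount {n} line = length (filter (λ j → Data.Bool.T? (is-just (line j))) (allFin n))
  where import Data.Bool

cellVal : Maybe ℤ → ℤ
cellVal (just z) = z
cellVal nothing  = + 0

lineSum : ∀ {n} → (Fin n → Maybe ℤ) → ℤ
lineSum {n} line = foldr ℤ._+_ (+ 0) (map (λ j → cellVal (line j)) (allFin n))

row : ∀ {n} → PartialArray n → Fin n → (Fin n → Maybe ℤ)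
row A i = λ j → A i j

col : ∀ {n} → PartialArray n → Fin n → (Fin n → Maybe ℤ)
col A j = λ i → A i j

record IsHeffter (n k : ℕ) (A : PartialArray n) : Set where
  field
    rowCount : ∀ i → filledCount (row A i) ≡ k
    colCount : ∀ j → filledCount (col A j) ≡ k
    rowSum   : ∀ i → (+ (2 * n * k + 1)) ∣ lineSum (row A i)
    colSum   : ∀ j → (+ (2 * n * k + 1)) ∣ lineSum (col A j)
    covers   : ∀ (x : ℕ) → 1 Data.Nat.≤ x → x Data.Nat.≤ n * k →
               Σ (Fin n) λ i → Σ (Fin n) λ j →
                 (A i j ≡ just (+ x)) ⊎ (A i j ≡ just (ℤ.- (+ x)))

HeffterArray : ℕ → ℕ → Set
HeffterArray n k = Σ (PartialArray n) (IsHeffter n k)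

module Submission where

-- The array is circulant: the entry in row i and column i + d (mod n) depends only on the
-- diagonal d and on i.  Write n = 2h + 1 and k = 4p + 5.  Exactly k diagonals are filled and,
-- for each b < k, one of them holds ±(bn + 1), …, ±(bn + n), one value per row, so every
-- 1 ≤ x ≤ nk occurs up to sign.  The entries are affine in i and in i + h, i + h + 1, i − 1
-- (mod n); the diagonals come in interleaved pairs whose contribution to a line does not depend
-- on the pair, and every line sums to 2nk + 1 or to 0 according as its index is at most h or not.
-- A row sum is a sum over the diagonals after a rotation of ℤ/n, a column sum after a reflection.
-- The construction works whenever n − k is even; n ≡ k ≡ 1 (mod 4) is only used to write
-- n = k + 2g.

open import Data.Bool using (T?)
open import Data.Fin using (Fin; toℕ; fromℕ<)
open import Data.Fin.Properties using (toℕ<n; toℕ-fromℕ<)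
open import Data.Integer as ℤ using (ℤ; +_; -_; _+_; _-_; _*_)
import Data.Integer.Divisibility as ℤ
import Data.Integer.Properties as ℤ
open import Data.Integer.Tactic.RingSolver using (solve-∀)
import Data.Nat.Tactic.RingSolver as ℕ-Solver
open import Data.List using (List; []; _∷_; foldr; map; filter; length; allFin; tabulate)
open import Data.List.Properties using (map-tabulate)
open import Data.Maybe using (Maybe; just; nothing; is-just)
open import Data.Nat as ℕ using (ℕ; zero; suc; _∸_; _<_; _≤_; z≤n; s≤s; NonZero; _%_; _/_)
import Data.Nat.Properties as ℕ
open import Data.Nat.Divisibility using (∣-refl; _∣0)
open import Data.Nat.DivMod
open import Data.Product using (Σ; _×_; _,_)
open import Data.Sum as Sum using (_⊎_; inj₁; inj₂)
open import Function using (id; _∘_)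
open import Relation.Nullary using (yes; no; contradiction)
open import Relation.Binary.PropositionalEquality

open import Defs

∑ : ℕ → (ℕ → ℤ) → ℤ
∑ zero    f = + 0
∑ (suc l) f = f 0 + ∑ l (f ∘ suc)

∑-cong : ∀ l {f g : ℕ → ℤ} → (∀ t → t < l → f t ≡ g t) → ∑ l f ≡ ∑ l g
∑-cong zero    f≡g = refl
∑-cong (suc l) f≡g = cong₂ _+_ (f≡g 0 (s≤s z≤n)) (∑-cong l (λ t t<l → f≡g (suc t) (s≤s t<l)))

∑-+ : ∀ a b (f : ℕ → ℤ) → ∑ (a ℕ.+ b) f ≡ ∑ a f + ∑ b (λ t → f (a ℕ.+ t))
∑-+ zero    b f = sym (ℤ.+-identityˡ _)
∑-+ (suc a) b f = trans (cong (λ x → f 0 + x) (∑-+ a b (f ∘ suc))) (sym (ℤ.+-assoc (f 0) _ _))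

∑-const : ∀ l c → ∑ l (λ _ → c) ≡ + l * c
∑-const zero    c = sym (ℤ.*-zeroˡ c)
∑-const (suc l) c = begin
  c + ∑ l (λ _ → c)   ≡⟨ cong (λ x → c + x) (∑-const l c) ⟩
  c + + l * c       ≡⟨ cong (ℤ._+ + l * c) (sym (ℤ.*-identityˡ c)) ⟩
  + 1 * c + + l * c ≡⟨ sym (ℤ.*-distribʳ-+ c (+ 1) (+ l)) ⟩
  + suc l * c         ∎
  where open ≡-Reasoning

∑-zero : ∀ l {f : ℕ → ℤ} → (∀ t → t < l → f t ≡ + 0) → ∑ l f ≡ + 0
∑-zero l f≡0 = trans (∑-cong l f≡0) (trans (∑-const l (+ 0)) (ℤ.*-zeroʳ (+ l)))

∑-reverse : ∀ l (f : ℕ → ℤ) → ∑ l (λ t → f (l ∸ suc t)) ≡ ∑ l f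
∑-reverse zero    f = refl
∑-reverse (suc l) f = begin
  f l + ∑ l (λ t → f (l ∸ suc t))  ≡⟨ cong (λ x → f l + x) (∑-reverse l f) ⟩
  f l + ∑ l f                      ≡⟨ ℤ.+-comm (f l) _ ⟩
  ∑ l f + f l                      ≡⟨ cong (λ x → ∑ l f + x) (sym (ℤ.+-identityʳ (f l))) ⟩
  ∑ l f + (f l + + 0)            ≡⟨ cong (λ x → ∑ l f + (f x + + 0)) (sym (ℕ.+-identityʳ l)) ⟩
  ∑ l f + ∑ 1 (λ t → f (l ℕ.+ t))    ≡⟨ sym (∑-+ l 1 f) ⟩
  ∑ (l ℕ.+ 1) f                        ≡⟨ cong (λ m → ∑ m f) (ℕ.+-comm l 1) ⟩
  ∑ (suc l) f                        ∎
  where open ≡-Reasoning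

module Cyclic (n : ℕ) .{{_ : NonZero n}} where

  -- j ⊖ d is j − d (mod n) only for d ≤ n.
  infixl 6 _⊕_ _⊖_
  _⊕_ _⊖_ : ℕ → ℕ → ℕ
  j ⊕ c = (j ℕ.+ c) % n
  j ⊖ d = (j ℕ.+ n ∸ d) % n

  [x%n+c]%n≡[x+c]%n : ∀ x c → (x % n ℕ.+ c) % n ≡ (x ℕ.+ c) % n
  [x%n+c]%n≡[x+c]%n x c = begin
    (x % n ℕ.+ c) % n            ≡⟨ %-distribˡ-+ (x % n) c n ⟩
    (x % n % n ℕ.+ c % n) % n    ≡⟨ cong (λ y → (y ℕ.+ c % n) % n) (m%n%n≡m%n x n) ⟩
    (x % n ℕ.+ c % n) % n        ≡⟨ sym (%-distribˡ-+ x c n) ⟩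
    (x ℕ.+ c) % n                ∎
    where open ≡-Reasoning

  ⊕-assoc : ∀ j a b → j ⊕ a ⊕ b ≡ j ⊕ (a ℕ.+ b)
  ⊕-assoc j a b = trans ([x%n+c]%n≡[x+c]%n (j ℕ.+ a) b) (cong (_% n) (ℕ.+-assoc j a b))

  ∑-rotate : ∀ a (f : ℕ → ℤ) → ∑ n (λ t → f (a ⊕ t)) ≡ ∑ n f
  ∑-rotate a f = begin
    ∑ n (λ t → f (a ⊕ t))                                  ≡⟨ ∑-cong n (λ t _ → cong f (sym ([x%n+c]%n≡[x+c]%n a t))) ⟩
    ∑ n g                                                   ≡⟨ cong (λ m → ∑ m g) (sym (ℕ.m∸n+n≡m a'≤n)) ⟩
    ∑ ((n ∸ a') ℕ.+ a') g                                   ≡⟨ ∑-+ (n ∸ a') a' g ⟩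
    ∑ (n ∸ a') g + ∑ a' (λ t → g ((n ∸ a') ℕ.+ t))          ≡⟨ cong₂ _+_ (∑-cong (n ∸ a') no-wrap) (∑-cong a' wrap) ⟩
    ∑ (n ∸ a') (λ t → f (a' ℕ.+ t)) + ∑ a' f               ≡⟨ ℤ.+-comm _ (∑ a' f) ⟩
    ∑ a' f + ∑ (n ∸ a') (λ t → f (a' ℕ.+ t))               ≡⟨ sym (∑-+ a' (n ∸ a') f) ⟩
    ∑ (a' ℕ.+ (n ∸ a')) f                                   ≡⟨ cong (λ m → ∑ m f) (ℕ.m+[n∸m]≡n a'≤n) ⟩
    ∑ n f                                                   ∎
    where
    open ≡-Reasoning
    a' = a % n
    a'≤n : a' ≤ n
    a'≤n = ℕ.<⇒≤ (m%n<n a n)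
    g : ℕ → ℤ
    g t = f ((a' ℕ.+ t) % n)
    no-wrap : ∀ t → t < n ∸ a' → g t ≡ f (a' ℕ.+ t)
    no-wrap t t<n∸a' = cong f (m<n⇒m%n≡m (subst (a' ℕ.+ t <_) (ℕ.m+[n∸m]≡n a'≤n) (ℕ.+-monoʳ-< a' t<n∸a')))
    wrap : ∀ t → t < a' → g ((n ∸ a') ℕ.+ t) ≡ f t
    wrap t t<a' = cong f (begin
      (a' ℕ.+ ((n ∸ a') ℕ.+ t)) % n  ≡⟨ cong (_% n) (sym (ℕ.+-assoc a' (n ∸ a') t)) ⟩
      (a' ℕ.+ (n ∸ a') ℕ.+ t) % n    ≡⟨ cong (λ m → (m ℕ.+ t) % n) (ℕ.m+[n∸m]≡n a'≤n) ⟩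
      (n ℕ.+ t) % n                  ≡⟨ cong (_% n) (ℕ.+-comm n t) ⟩
      (t ℕ.+ n) % n                  ≡⟨ [m+n]%n≡m%n t n ⟩
      t % n                          ≡⟨ m<n⇒m%n≡m (ℕ.<-trans t<a' (m%n<n a n)) ⟩
      t                              ∎)

  ∑-reflect : ∀ j (f : ℕ → ℤ) → ∑ n (λ d → f (j ⊖ d)) ≡ ∑ n f
  ∑-reflect j f = begin
    ∑ n (λ d → f (j ⊖ d))                         ≡⟨ sym (∑-reverse n (λ d → f (j ⊖ d))) ⟩
    ∑ n (λ t → f (j ⊖ (n ∸ suc t)))               ≡⟨ ∑-cong n (λ t t<n → cong (λ m → f (m % n)) (index t t<n)) ⟩
    ∑ n (λ t → f (suc j ⊕ t))                     ≡⟨ ∑-rotate (suc j) f ⟩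
    ∑ n f                                         ∎
    where
    open ≡-Reasoning
    index : ∀ t → t < n → j ℕ.+ n ∸ (n ∸ suc t) ≡ suc j ℕ.+ t
    index t t<n = trans (ℕ.+-∸-assoc j (ℕ.m∸n≤m n (suc t)))
      (trans (cong (j ℕ.+_) (ℕ.m∸[m∸n]≡n t<n)) (ℕ.+-suc j t))

  i⊕d⊖i≡d : ∀ i d → i < n → d < n → i ⊕ d ⊖ i ≡ d
  i⊕d⊖i≡d i d i<n d<n with i ℕ.+ d ℕ.<? n
  ... | yes i+d<n = begin
    ((i ℕ.+ d) % n ℕ.+ n ∸ i) % n  ≡⟨ cong (λ x → (x ℕ.+ n ∸ i) % n) (m<n⇒m%n≡m i+d<n) ⟩
    (i ℕ.+ d ℕ.+ n ∸ i) % n        ≡⟨ cong (_% n) (trans (cong (_∸ i) (ℕ.+-assoc i d n)) (ℕ.m+n∸m≡n i (d ℕ.+ n))) ⟩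
    (d ℕ.+ n) % n                  ≡⟨ [m+n]%n≡m%n d n ⟩
    d % n                          ≡⟨ m<n⇒m%n≡m d<n ⟩
    d                              ∎
    where open ≡-Reasoning
  ... | no i+d≮n = begin
    ((i ℕ.+ d) % n ℕ.+ n ∸ i) % n  ≡⟨ cong (λ x → (x ℕ.+ n ∸ i) % n) [i+d]%n≡w ⟩
    (w ℕ.+ n ∸ i) % n              ≡⟨ cong (λ x → (x ∸ i) % n) w+n≡i+d ⟩
    (i ℕ.+ d ∸ i) % n              ≡⟨ cong (_% n) (ℕ.m+n∸m≡n i d) ⟩
    d % n                          ≡⟨ m<n⇒m%n≡m d<n ⟩
    d                              ∎
    where
    open ≡-Reasoning
    w = i ℕ.+ d ∸ n
    w+n≡i+d : w ℕ.+ n ≡ i ℕ.+ d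
    w+n≡i+d = ℕ.m∸n+n≡m (ℕ.≮⇒≥ i+d≮n)
    w<n : w < n
    w<n = ℕ.+-cancelʳ-< n w n (subst (_< n ℕ.+ n) (sym w+n≡i+d) (ℕ.+-mono-< i<n d<n))
    [i+d]%n≡w : (i ℕ.+ d) % n ≡ w
    [i+d]%n≡w = trans (cong (_% n) (sym w+n≡i+d)) (trans ([m+n]%n≡m%n w n) (m<n⇒m%n≡m w<n))

  j⊖[j⊖d]≡d : ∀ j d → j < n → d < n → j ⊖ (j ⊖ d) ≡ d
  j⊖[j⊖d]≡d j d j<n d<n with d ℕ.≤? j
  ... | yes d≤j = begin
    (j ℕ.+ n ∸ (j ⊖ d)) % n  ≡⟨ cong (λ x → (j ℕ.+ n ∸ x) % n) j⊖d≡j∸d ⟩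
    (j ℕ.+ n ∸ (j ∸ d)) % n  ≡⟨ cong (_% n) (ℕ.+-∸-comm n (ℕ.m∸n≤m j d)) ⟩
    (j ∸ (j ∸ d) ℕ.+ n) % n  ≡⟨ cong (λ x → (x ℕ.+ n) % n) (ℕ.m∸[m∸n]≡n d≤j) ⟩
    (d ℕ.+ n) % n            ≡⟨ [m+n]%n≡m%n d n ⟩
    d % n                    ≡⟨ m<n⇒m%n≡m d<n ⟩
    d                        ∎
    where
    open ≡-Reasoning
    j⊖d≡j∸d : j ⊖ d ≡ j ∸ d
    j⊖d≡j∸d = trans (cong (_% n) (ℕ.+-∸-comm n d≤j))
      (trans ([m+n]%n≡m%n (j ∸ d) n) (m<n⇒m%n≡m (ℕ.≤-<-trans (ℕ.m∸n≤m j d) j<n)))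
  ... | no d≰j = begin
    (j ℕ.+ n ∸ (j ⊖ d)) % n          ≡⟨ cong (λ x → (j ℕ.+ n ∸ x) % n) (m<n⇒m%n≡m j+n∸d<n) ⟩
    (j ℕ.+ n ∸ (j ℕ.+ n ∸ d)) % n    ≡⟨ cong (_% n) (ℕ.m∸[m∸n]≡n d≤j+n) ⟩
    d % n                            ≡⟨ m<n⇒m%n≡m d<n ⟩
    d                                ∎
    where
    open ≡-Reasoning
    d≤j+n : d ≤ j ℕ.+ n
    d≤j+n = ℕ.≤-trans (ℕ.<⇒≤ d<n) (ℕ.m≤n+m n j)
    j+n∸d<n : j ℕ.+ n ∸ d < n
    j+n∸d<n = ℕ.+-cancelˡ-< d (j ℕ.+ n ∸ d) n
      (subst (_< d ℕ.+ n) (sym (ℕ.m+[n∸m]≡n d≤j+n)) (ℕ.+-monoˡ-< n (ℕ.≰⇒> d≰j)))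

  ⊕-+n : ∀ j a → j ⊕ (a ℕ.+ n) ≡ j ⊕ a
  ⊕-+n j a = trans (cong (_% n) (sym (ℕ.+-assoc j a n))) ([m+n]%n≡m%n (j ℕ.+ a) n)

  ⊕-identityʳ : ∀ j → j < n → j ⊕ 0 ≡ j
  ⊕-identityʳ j j<n = trans (cong (_% n) (ℕ.+-identityʳ j)) (m<n⇒m%n≡m j<n)

  ⊖≡⊕ : ∀ j d e → d ℕ.+ e ≡ n → j ⊖ d ≡ j ⊕ e
  ⊖≡⊕ j d e d+e≡n = cong (_% n) (begin
    j ℕ.+ n ∸ d              ≡⟨ cong (λ m → j ℕ.+ m ∸ d) (sym d+e≡n) ⟩
    j ℕ.+ (d ℕ.+ e) ∸ d      ≡⟨ ℕ.+-∸-assoc j (ℕ.m≤m+n d e) ⟩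
    j ℕ.+ (d ℕ.+ e ∸ d)      ≡⟨ cong (j ℕ.+_) (ℕ.m+n∸m≡n d e) ⟩
    j ℕ.+ e                  ∎)
    where open ≡-Reasoning

  ⊖-suc : ∀ j d → suc d ≤ n → j ⊖ d ⊕ (n ∸ 1) ≡ j ⊖ suc d
  ⊖-suc j d 1+d≤n = begin
    (j ⊖ d ℕ.+ (n ∸ 1)) % n          ≡⟨ [x%n+c]%n≡[x+c]%n (j ℕ.+ n ∸ d) (n ∸ 1) ⟩
    (j ℕ.+ n ∸ d ℕ.+ (n ∸ 1)) % n    ≡⟨ cong (λ x → (x ℕ.+ (n ∸ 1)) % n) (ℕ.+-∸-assoc 1 1+d≤j+n) ⟩
    (suc y ℕ.+ (n ∸ 1)) % n          ≡⟨ cong (_% n) (trans (sym (ℕ.+-suc y (n ∸ 1))) (cong (y ℕ.+_) (ℕ.suc-pred n))) ⟩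
    (y ℕ.+ n) % n                    ≡⟨ [m+n]%n≡m%n y n ⟩
    j ⊖ suc d                        ∎
    where
    open ≡-Reasoning
    y = j ℕ.+ n ∸ suc d
    1+d≤j+n : suc d ≤ j ℕ.+ n
    1+d≤j+n = ℕ.≤-trans 1+d≤n (ℕ.m≤n+m n j)

  ⊕-⊕-wrap : ∀ j a b c → a ℕ.+ b ≡ c ℕ.+ n → j ⊕ a ⊕ b ≡ j ⊕ c
  ⊕-⊕-wrap j a b c a+b≡c+n = trans (⊕-assoc j a b) (trans (cong (j ⊕_) a+b≡c+n) (⊕-+n j c))

  ⊕-wrap : ∀ x c y → x ℕ.+ c ≡ y ℕ.+ n → y < n → x ⊕ c ≡ y
  ⊕-wrap x c y x+c≡y+n y<n = trans (cong (_% n) x+c≡y+n) (trans ([m+n]%n≡m%n y n) (m<n⇒m%n≡m y<n))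

  ⊖-⊕-inverse : ∀ r a → r < n → a ≤ n → r ⊖ a ⊕ a ≡ r
  ⊖-⊕-inverse r a r<n a≤n = begin
    (r ⊖ a ℕ.+ a) % n        ≡⟨ [x%n+c]%n≡[x+c]%n (r ℕ.+ n ∸ a) a ⟩
    (r ℕ.+ n ∸ a ℕ.+ a) % n  ≡⟨ cong (_% n) (ℕ.m∸n+n≡m (ℕ.≤-trans a≤n (ℕ.m≤n+m n r))) ⟩
    (r ℕ.+ n) % n            ≡⟨ [m+n]%n≡m%n r n ⟩
    r % n                    ≡⟨ m<n⇒m%n≡m r<n ⟩
    r                        ∎
    where open ≡-Reasoning

  ⊕-surjective : ∀ a → a ≤ n → ∀ r → r < n → Σ ℕ λ i → i < n × i ⊕ a ≡ r
  ⊕-surjective a a≤n r r<n = r ⊖ a , m%n<n (r ℕ.+ n ∸ a) n , ⊖-⊕-inverse r a r<n a≤n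

Diagonal : Set
Diagonal = ℕ → Maybe ℤ

infix 4 _≡±_
_≡±_ : Maybe ℤ → ℤ → Set
c ≡± z = c ≡ just z ⊎ c ≡ just (- z)

filledIndicator : Maybe ℤ → ℤ
filledIndicator (just _) = + 1
filledIndicator nothing  = + 0

foldr-map-allFin : ∀ n (g : ℕ → ℤ) → foldr _+_ (+ 0) (map (g ∘ toℕ) (allFin n)) ≡ ∑ n g
foldr-map-allFin n g = trans (cong (foldr _+_ (+ 0)) (map-tabulate {n = n} id (g ∘ toℕ))) (foldr-tabulate n g)
  where
  foldr-tabulate : ∀ n (g : ℕ → ℤ) → foldr _+_ (+ 0) (tabulate {n = n} (g ∘ toℕ)) ≡ ∑ n g
  foldr-tabulate zero    g = refl
  foldr-tabulate (suc n) g = cong (λ x → g 0 + x) (foldr-tabulate n (g ∘ suc))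

length-filter-filled : ∀ {n} (xs : List (Fin n)) (line : Fin n → Maybe ℤ) →
  + length (filter (λ j → T? (is-just (line j))) xs) ≡ foldr _+_ (+ 0) (map (filledIndicator ∘ line) xs)
length-filter-filled []       line = refl
length-filter-filled (x ∷ xs) line with line x | length-filter-filled xs line
... | just _  | ih = cong (λ c → + 1 + c) ih
... | nothing | ih = trans ih (sym (ℤ.+-identityˡ _))

module DiagonalArray (n : ℕ) .{{_ : NonZero n}} (D : ℕ → Diagonal) where

  open Cyclic n

  -- D d i is the entry of row i on the d-th diagonal, in column i + d (mod n).
  array : PartialArray n
  array i j = D (toℕ j ⊖ toℕ i) (toℕ i)

  row-∑ : ∀ (Φ : Maybe ℤ → ℤ) i → i < n → ∑ n (λ j → Φ (D (j ⊖ i) i)) ≡ ∑ n (λ d → Φ (D d i))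
  row-∑ Φ i i<n = trans (sym (∑-rotate i (λ j → Φ (D (j ⊖ i) i))))
    (∑-cong n (λ d d<n → cong (λ e → Φ (D e i)) (i⊕d⊖i≡d i d i<n d<n)))

  col-∑ : ∀ (Φ : Maybe ℤ → ℤ) j → j < n → ∑ n (λ i → Φ (D (j ⊖ i) i)) ≡ ∑ n (λ d → Φ (D d (j ⊖ d)))
  col-∑ Φ j j<n = trans (sym (∑-reflect j (λ i → Φ (D (j ⊖ i) i))))
    (∑-cong n (λ d d<n → cong (λ e → Φ (D e (j ⊖ d))) (j⊖[j⊖d]≡d j d j<n d<n)))

  isHeffter : ∀ k →
    (∀ (r : ℕ → ℕ) → ∑ n (λ d → filledIndicator (D d (r d))) ≡ + k) →
    (∀ i → i < n → + (2 ℕ.* n ℕ.* k ℕ.+ 1) ℤ.∣ ∑ n (λ d → cellVal (D d i))) →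
    (∀ j → j < n → + (2 ℕ.* n ℕ.* k ℕ.+ 1) ℤ.∣ ∑ n (λ d → cellVal (D d (j ⊖ d)))) →
    (∀ x → 1 ≤ x → x ≤ n ℕ.* k → Σ ℕ λ i → Σ ℕ λ d → i < n × d < n × D d i ≡± + x) →
    IsHeffter n k array
  isHeffter k count rowSum colSum covers = record
    { rowCount = λ i → ℤ.+-injective (trans (length-filter-filled (allFin n) (row array i))
        (trans (foldr-map-allFin n _) (trans (row-∑ filledIndicator (toℕ i) (toℕ<n i)) (count (λ _ → toℕ i)))))
    ; colCount = λ j → ℤ.+-injective (trans (length-filter-filled (allFin n) (col array j))
        (trans (foldr-map-allFin n _) (trans (col-∑ filledIndicator (toℕ j) (toℕ<n j)) (count (toℕ j ⊖_)))))
    ; rowSum = λ i → subst (m ℤ.∣_) (sym (trans (foldr-map-allFin n _) (row-∑ cellVal (toℕ i) (toℕ<n i))))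
        (rowSum (toℕ i) (toℕ<n i))
    ; colSum = λ j → subst (m ℤ.∣_) (sym (trans (foldr-map-allFin n _) (col-∑ cellVal (toℕ j) (toℕ<n j))))
        (colSum (toℕ j) (toℕ<n j))
    ; covers = λ x 1≤x x≤nk → cell (covers x 1≤x x≤nk)
    }
    where
    m = + (2 ℕ.* n ℕ.* k ℕ.+ 1)
    cell : ∀ {x} → (Σ ℕ λ i → Σ ℕ λ d → i < n × d < n × D d i ≡± + x) →
           Σ (Fin n) λ i → Σ (Fin n) λ j → array i j ≡± + x
    cell (i , d , i<n , d<n , Ddi≡±x) = fromℕ< i<n , fromℕ< (m%n<n (i ℕ.+ d) n) , Sum.map (trans entry) (trans entry) Ddi≡±x
      where
      entry : array (fromℕ< i<n) (fromℕ< (m%n<n (i ℕ.+ d) n)) ≡ D d i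
      entry = trans (cong₂ (λ j i → D (j ⊖ i) i) (toℕ-fromℕ< _) (toℕ-fromℕ< i<n))
                    (cong (λ e → D e i) (i⊕d⊖i≡d i d i<n d<n))

module _ {A : Set} where

  infixr 5 _∷ˢ_ _⟨_⟩_

  _∷ˢ_ : A → (ℕ → A) → ℕ → A
  (x ∷ˢ s) zero    = x
  (x ∷ˢ s) (suc d) = s d

  _⟨_⟩_ : (ℕ → A) → ℕ → (ℕ → A) → ℕ → A
  (s ⟨ zero  ⟩ t) d       = t d
  (s ⟨ suc l ⟩ t) zero    = s 0
  (s ⟨ suc l ⟩ t) (suc d) = ((s ∘ suc) ⟨ l ⟩ t) d

  interleave : (ℕ → A) → (ℕ → A) → ℕ → A
  interleave s t zero          = s 0
  interleave s t (suc zero)    = t 0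
  interleave s t (suc (suc d)) = interleave (s ∘ suc) (t ∘ suc) d

  ⟨⟩-lookupˡ : ∀ l (s t : ℕ → A) {d} → d < l → (s ⟨ l ⟩ t) d ≡ s d
  ⟨⟩-lookupˡ (suc l) s t {zero}  _         = refl
  ⟨⟩-lookupˡ (suc l) s t {suc d} (s≤s d<l) = ⟨⟩-lookupˡ l (s ∘ suc) t d<l

  ⟨⟩-lookupʳ : ∀ l (s t : ℕ → A) d → (s ⟨ l ⟩ t) (d ℕ.+ l) ≡ t d
  ⟨⟩-lookupʳ l s t d = trans (cong (s ⟨ l ⟩ t) (ℕ.+-comm d l)) (lookup l s)
    where
    lookup : ∀ l (s : ℕ → A) → (s ⟨ l ⟩ t) (l ℕ.+ d) ≡ t d
    lookup zero    s = refl
    lookup (suc l) s = lookup l (s ∘ suc)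

  interleave-even : ∀ (s t : ℕ → A) q → interleave s t (q ℕ.+ q) ≡ s q
  interleave-even s t zero    = refl
  interleave-even s t (suc q) = trans (cong (interleave s t ∘ suc) (ℕ.+-suc q q)) (interleave-even (s ∘ suc) (t ∘ suc) q)

  interleave-odd : ∀ (s t : ℕ → A) q → interleave s t (suc (q ℕ.+ q)) ≡ t q
  interleave-odd s t zero    = refl
  interleave-odd s t (suc q) = trans (cong (interleave s t ∘ suc ∘ suc) (ℕ.+-suc q q)) (interleave-odd (s ∘ suc) (t ∘ suc) q)

  ∑-⟨⟩ : ∀ l m (s t : ℕ → A) (F : A → ℕ → ℤ) →
    ∑ (l ℕ.+ m) (λ d → F ((s ⟨ l ⟩ t) d) d) ≡ ∑ l (λ d → F (s d) d) + ∑ m (λ d → F (t d) (d ℕ.+ l))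
  ∑-⟨⟩ zero    m s t F = trans (sym (ℤ.+-identityˡ _))
    (cong (λ x → + 0 + x) (∑-cong m (λ d _ → cong (F (t d)) (sym (ℕ.+-identityʳ d)))))
  ∑-⟨⟩ (suc l) m s t F = begin
    F (s 0) 0 + ∑ (l ℕ.+ m) (λ d → F (((s ∘ suc) ⟨ l ⟩ t) d) (suc d))
      ≡⟨ cong (λ x → F (s 0) 0 + x) (∑-⟨⟩ l m (s ∘ suc) t (λ a → F a ∘ suc)) ⟩
    F (s 0) 0 + (∑ l (λ d → F (s (suc d)) (suc d)) + ∑ m (λ d → F (t d) (suc (d ℕ.+ l))))
      ≡⟨ sym (ℤ.+-assoc (F (s 0) 0) _ _) ⟩
    ∑ (suc l) (λ d → F (s d) d) + ∑ m (λ d → F (t d) (suc (d ℕ.+ l)))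
      ≡⟨ cong (λ x → ∑ (suc l) (λ d → F (s d) d) + x) (∑-cong m (λ d _ → cong (F (t d)) (sym (ℕ.+-suc d l)))) ⟩
    ∑ (suc l) (λ d → F (s d) d) + ∑ m (λ d → F (t d) (d ℕ.+ suc l))
      ∎
    where open ≡-Reasoning

  ∑-⟨⟩-zero : ∀ l m (s t : ℕ → A) (F : A → ℕ → ℤ) → (∀ d → F (s d) d ≡ + 0) →
    ∑ (l ℕ.+ m) (λ d → F ((s ⟨ l ⟩ t) d) d) ≡ ∑ m (λ d → F (t d) (d ℕ.+ l))
  ∑-⟨⟩-zero l m s t F Fs≡0 = trans (∑-⟨⟩ l m s t F)
    (trans (cong (_+ ∑ m (λ d → F (t d) (d ℕ.+ l))) (∑-zero l (λ d _ → Fs≡0 d))) (ℤ.+-identityˡ _))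

  ∑-interleave : ∀ p (s t : ℕ → A) (F : A → ℕ → ℤ) →
    ∑ (p ℕ.+ p) (λ d → F (interleave s t d) d) ≡ ∑ p (λ q → F (s q) (q ℕ.+ q) + F (t q) (suc (q ℕ.+ q)))
  ∑-interleave zero    s t F = refl
  ∑-interleave (suc p) s t F = begin
    ∑ (suc p ℕ.+ suc p) f
      ≡⟨ cong (λ m → ∑ (suc m) f) (ℕ.+-suc p p) ⟩
    F (s 0) 0 + (F (t 0) 1 + ∑ (p ℕ.+ p) (f ∘ suc ∘ suc))
      ≡⟨ cong (λ x → F (s 0) 0 + (F (t 0) 1 + x)) (∑-interleave p (s ∘ suc) (t ∘ suc) (λ a → F a ∘ suc ∘ suc)) ⟩
    F (s 0) 0 + (F (t 0) 1 + ∑ p g)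
      ≡⟨ sym (ℤ.+-assoc (F (s 0) 0) _ _) ⟩
    F (s 0) 0 + F (t 0) 1 + ∑ p g
      ≡⟨ cong (λ x → F (s 0) 0 + F (t 0) 1 + x) (∑-cong p (λ q _ → g≡ q)) ⟩
    ∑ (suc p) (λ q → F (s q) (q ℕ.+ q) + F (t q) (suc (q ℕ.+ q)))
      ∎
    where
    open ≡-Reasoning
    f : ℕ → ℤ
    f d = F (interleave s t d) d
    g : ℕ → ℤ
    g q = F (s (suc q)) (suc (suc (q ℕ.+ q))) + F (t (suc q)) (suc (suc (suc (q ℕ.+ q))))
    g≡ : ∀ q → g q ≡ F (s (suc q)) (suc q ℕ.+ suc q) + F (t (suc q)) (suc (suc q ℕ.+ suc q))
    g≡ q = cong₂ (λ a b → F (s (suc q)) a + F (t (suc q)) (suc b)) 2+2q 2+2q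
      where
      2+2q : suc (suc (q ℕ.+ q)) ≡ suc q ℕ.+ suc q
      2+2q = cong suc (sym (ℕ.+-suc q q))

even-or-odd : ∀ r → Σ ℕ λ s → r ≡ s ℕ.+ s ⊎ r ≡ suc (s ℕ.+ s)
even-or-odd zero = 0 , inj₁ refl
even-or-odd (suc r) with even-or-odd r
... | s , inj₁ r≡s+s     = s , inj₂ (cong suc r≡s+s)
... | s , inj₂ r≡1+s+s   = suc s , inj₁ (cong suc (trans r≡1+s+s (sym (ℕ.+-suc s s))))

half-≤ : ∀ {s t} → s ℕ.+ s ≤ t ℕ.+ t → s ≤ t
half-≤ s+s≤t+t = ℕ.≮⇒≥ (λ t<s → ℕ.<⇒≱ (ℕ.+-mono-< t<s t<s) s+s≤t+t)

half-< : ∀ {s t} → suc (s ℕ.+ s) ≤ t ℕ.+ t → s < t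
half-< s+s<t+t = ℕ.≰⇒> (λ t≤s → ℕ.<⇒≱ s+s<t+t (ℕ.+-mono-≤ t≤s t≤s))

pos-∸ : ∀ {m n} → n ≤ m → + (m ∸ n) ≡ + m - + n
pos-∸ {m} {n} n≤m = trans (sym (ℤ.⊖-≥ n≤m)) (sym (ℤ.[+m]-[+n]≡m⊖n m n))

module Construction (g p : ℕ) where

  h : ℕ
  h = g ℕ.+ (p ℕ.+ p) ℕ.+ 2

  n : ℕ
  n = suc (h ℕ.+ h)

  k : ℕ
  k = 5 ℕ.+ 4 ℕ.* p

  open Cyclic n

  H P N : ℤ
  H = + h
  P = + p
  N = + 2 * H + + 1

  weight : ℕ → ℤ
  weight i with i ℕ.≤? h
  ... | yes _ = (+ 4 + + 4 * P) * N + + 1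
  ... | no  _ = - ((+ 6 + + 4 * P) * N)

  -- bandᵦ holds ±(bn + 1), …, ±(bn + n): band₄ q … band₇ q have b = 4q + 4 … 4q + 7,
  -- and bandTop has b = k − 1.
  ∅ band₀ band₁ band₂ band₃ bandTop : Diagonal
  ∅ _       = nothing
  band₀ i   = just (+ 3 * H + + 1 - (+ i + + (i ⊕ suc h)))
  band₁ i   = just (- (H + + 2 + + i + + (i ⊕ h)))
  band₂ i   = just (+ 2 * N + + 1 + + (i ⊕ suc h))
  band₃ i   = just (+ 3 * N + + 1 + + (i ⊕ h))
  bandTop i = just (+ i + + i + weight i)

  band₄ band₅ band₆ band₇ : ℕ → Diagonal
  band₄ q i = just (- ((+ 4 + + 4 * + q) * N + + 1 + + (i ⊕ (n ∸ 1))))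
  band₅ q i = just (+ (i ⊕ (n ∸ 1)) - (+ 6 + + 4 * + q) * N)
  band₆ q i = just ((+ 7 + + 4 * + q) * N - + i)
  band₇ q i = just ((+ 7 + + 4 * + q) * N + + 1 + + i)

  tailBlock upperBlock midBlock lowerBlock layout : ℕ → Diagonal
  tailBlock  = (λ _ → ∅) ⟨ g ⟩ (λ _ → band₃)
  upperBlock = interleave band₄ band₇ ⟨ p ℕ.+ p ⟩ tailBlock
  midBlock   = band₁ ∷ˢ band₀ ∷ˢ upperBlock
  lowerBlock = interleave band₅ band₆ ⟨ p ℕ.+ p ⟩ midBlock
  layout     = bandTop ∷ˢ band₂ ∷ˢ (λ _ → ∅) ⟨ g ⟩ lowerBlock

  -- The offsets are added on the right, as ∑-⟨⟩ produces them, so that positions match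
  -- definitionally.
  lowerPos upperPos : ℕ → ℕ
  lowerPos q = suc (suc (q ℕ.+ q ℕ.+ g))
  upperPos q = suc (suc (suc (suc (q ℕ.+ q)) ℕ.+ (p ℕ.+ p) ℕ.+ g))

  midPos lastPos : ℕ
  midPos  = suc (suc (p ℕ.+ p ℕ.+ g))
  lastPos = suc (suc (suc (suc (g ℕ.+ (p ℕ.+ p))) ℕ.+ (p ℕ.+ p) ℕ.+ g))

  +n≡N : + n ≡ N
  +n≡N = arith H
    where
    arith : ∀ H → + 1 + (H + H) ≡ + 2 * H + + 1
    arith = solve-∀

  +k≡5+4P : + k ≡ + 5 + + 4 * P
  +k≡5+4P = cong (λ x → + 5 + x) (ℤ.pos-* 4 p)

  +2nk+1≡ : + (2 ℕ.* n ℕ.* k ℕ.+ 1) ≡ (+ 10 + + 8 * P) * N + + 1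
  +2nk+1≡ = cong (_+ + 1) (trans (ℤ.pos-* (2 ℕ.* n) k)
    (trans (cong₂ _*_ (trans (ℤ.pos-* 2 n) (cong (+ 2 *_) +n≡N)) +k≡5+4P) (arith P H)))
    where
    arith : ∀ P H → + 2 * (+ 2 * H + + 1) * (+ 5 + + 4 * P) ≡ (+ 10 + + 8 * P) * (+ 2 * H + + 1)
    arith = solve-∀

  h<n : h < n
  h<n = s≤s (ℕ.m≤m+n h h)

  0<h : 0 < h
  0<h = ℕ.<-≤-trans (s≤s z≤n) (ℕ.m≤n+m 2 (g ℕ.+ (p ℕ.+ p)))

  midPos+h+1≡n : midPos ℕ.+ suc h ≡ n
  midPos+h+1≡n = arith g p
    where
    arith : ∀ g p → let h = g ℕ.+ (p ℕ.+ p) ℕ.+ 2 in suc (suc (p ℕ.+ p ℕ.+ g)) ℕ.+ suc h ≡ suc (h ℕ.+ h)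
    arith = ℕ-Solver.solve-∀

  midPos+1+h≡n : suc midPos ℕ.+ h ≡ n
  midPos+1+h≡n = arith g p
    where
    arith : ∀ g p → let h = g ℕ.+ (p ℕ.+ p) ℕ.+ 2 in suc (suc (suc (p ℕ.+ p ℕ.+ g))) ℕ.+ h ≡ suc (h ℕ.+ h)
    arith = ℕ-Solver.solve-∀

  lastPos+1≡n : lastPos ℕ.+ 1 ≡ n
  lastPos+1≡n = arith g p
    where
    arith : ∀ g p → let h = g ℕ.+ (p ℕ.+ p) ℕ.+ 2 in
      suc (suc (suc (suc (g ℕ.+ (p ℕ.+ p))) ℕ.+ (p ℕ.+ p) ℕ.+ g)) ℕ.+ 1 ≡ suc (h ℕ.+ h)
    arith = ℕ-Solver.solve-∀

  midPos+1<n : suc midPos < n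
  midPos+1<n = subst (suc midPos <_) midPos+1+h≡n (ℕ.m<m+n (suc midPos) 0<h)

  lowerPos-bound : ∀ q → q < p → suc (suc (lowerPos q)) ≤ n
  lowerPos-bound q q<p = subst (suc (suc (lowerPos q)) ≤_) (sym n≡) (ℕ.m≤m+n _ _)
    where
    r = p ∸ suc q
    n≡ : n ≡ suc (suc (lowerPos q)) ℕ.+ (g ℕ.+ (q ℕ.+ q) ℕ.+ 4 ℕ.* r ℕ.+ 5)
    n≡ = subst (λ x → suc (g ℕ.+ (x ℕ.+ x) ℕ.+ 2 ℕ.+ (g ℕ.+ (x ℕ.+ x) ℕ.+ 2))
                       ≡ suc (suc (lowerPos q)) ℕ.+ (g ℕ.+ (q ℕ.+ q) ℕ.+ 4 ℕ.* r ℕ.+ 5))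
               (ℕ.m+[n∸m]≡n q<p) (arith g q r)
      where
      arith : ∀ g q r → let p = suc q ℕ.+ r ; h = g ℕ.+ (p ℕ.+ p) ℕ.+ 2 in
        suc (h ℕ.+ h) ≡ suc (suc (suc (suc (q ℕ.+ q ℕ.+ g)))) ℕ.+ (g ℕ.+ (q ℕ.+ q) ℕ.+ 4 ℕ.* r ℕ.+ 5)
      arith = ℕ-Solver.solve-∀

  upperPos-bound : ∀ q → q < p → suc (suc (upperPos q)) ≤ n
  upperPos-bound q q<p = subst (suc (suc (upperPos q)) ≤_) (sym n≡) (ℕ.m≤m+n _ _)
    where
    r = p ∸ suc q
    n≡ : n ≡ suc (suc (upperPos q)) ℕ.+ (g ℕ.+ 2 ℕ.* r ℕ.+ 1)
    n≡ = subst (λ x → suc (g ℕ.+ (x ℕ.+ x) ℕ.+ 2 ℕ.+ (g ℕ.+ (x ℕ.+ x) ℕ.+ 2))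
                       ≡ suc (suc (suc (suc (suc (suc (q ℕ.+ q)) ℕ.+ (x ℕ.+ x) ℕ.+ g)))) ℕ.+ (g ℕ.+ 2 ℕ.* r ℕ.+ 1))
               (ℕ.m+[n∸m]≡n q<p) (arith g q r)
      where
      arith : ∀ g q r → let p = suc q ℕ.+ r ; h = g ℕ.+ (p ℕ.+ p) ℕ.+ 2 in
        suc (h ℕ.+ h) ≡ suc (suc (suc (suc (suc (suc (q ℕ.+ q)) ℕ.+ (p ℕ.+ p) ℕ.+ g)))) ℕ.+ (g ℕ.+ 2 ℕ.* r ℕ.+ 1)
      arith = ℕ-Solver.solve-∀

  lineTotal : ℤ → ℤ → ℤ → ℤ → ℤ → ℤ → ℤ → ℤ
  lineTotal t b₂ L b₁ b₀ U b₃ = t + (b₂ + (L + (b₁ + (b₀ + (U + b₃)))))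

  lineTotal-cong : ∀ {t t' b₂ b₂' b₁ b₁' b₀ b₀' b₃ b₃'} L U →
    t ≡ t' → b₂ ≡ b₂' → b₁ ≡ b₁' → b₀ ≡ b₀' → b₃ ≡ b₃' →
    lineTotal t b₂ L b₁ b₀ U b₃ ≡ lineTotal t' b₂' L b₁' b₀' U b₃'
  lineTotal-cong L U refl refl refl refl refl = refl

  ∑-tailBlock : ∀ F → (∀ d → F ∅ d ≡ + 0) → ∑ (g ℕ.+ 1) (λ d → F (tailBlock d) d) ≡ F band₃ g
  ∑-tailBlock F F∅≡0 = trans (∑-⟨⟩-zero g 1 (λ _ → ∅) (λ _ → band₃) F F∅≡0) (ℤ.+-identityʳ (F band₃ g))

  ∑-upperBlock : ∀ F → (∀ d → F ∅ d ≡ + 0) →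
    ∑ (p ℕ.+ p ℕ.+ (g ℕ.+ 1)) (λ d → F (upperBlock d) d) ≡
      ∑ p (λ q → F (band₄ q) (q ℕ.+ q) + F (band₇ q) (suc (q ℕ.+ q))) + F band₃ (g ℕ.+ (p ℕ.+ p))
  ∑-upperBlock F F∅≡0 = trans (∑-⟨⟩ (p ℕ.+ p) (g ℕ.+ 1) (interleave band₄ band₇) tailBlock F)
    (cong₂ _+_ (∑-interleave p band₄ band₇ F) (∑-tailBlock (λ δ d → F δ (d ℕ.+ (p ℕ.+ p))) (λ d → F∅≡0 _)))

  ∑-lowerBlock : ∀ F → (∀ d → F ∅ d ≡ + 0) →
    ∑ (p ℕ.+ p ℕ.+ suc (suc (p ℕ.+ p ℕ.+ (g ℕ.+ 1)))) (λ d → F (lowerBlock d) d) ≡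
      ∑ p (λ q → F (band₅ q) (q ℕ.+ q) + F (band₆ q) (suc (q ℕ.+ q))) + (F band₁ (p ℕ.+ p) + (F band₀ (suc (p ℕ.+ p)) +
        (∑ p (λ q → F (band₄ q) (suc (suc (q ℕ.+ q)) ℕ.+ (p ℕ.+ p)) + F (band₇ q) (suc (suc (suc (q ℕ.+ q))) ℕ.+ (p ℕ.+ p))) +
         F band₃ (suc (suc (g ℕ.+ (p ℕ.+ p))) ℕ.+ (p ℕ.+ p)))))
  ∑-lowerBlock F F∅≡0 = trans (∑-⟨⟩ (p ℕ.+ p) _ (interleave band₅ band₆) midBlock F)
    (cong₂ _+_
      (∑-interleave p band₅ band₆ F)
      (cong (λ x → F band₁ (p ℕ.+ p) + (F band₀ (suc (p ℕ.+ p)) + x))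
        (∑-upperBlock (λ δ d → F δ (suc (suc d) ℕ.+ (p ℕ.+ p))) (λ d → F∅≡0 _))))

  ∑-layout : ∀ (F : Diagonal → ℕ → ℤ) → (∀ d → F ∅ d ≡ + 0) →
    ∑ n (λ d → F (layout d) d) ≡
      lineTotal (F bandTop 0) (F band₂ 1) (∑ p (λ q → F (band₅ q) (lowerPos q) + F (band₆ q) (suc (lowerPos q))))
        (F band₁ midPos) (F band₀ (suc midPos))
        (∑ p (λ q → F (band₄ q) (upperPos q) + F (band₇ q) (suc (upperPos q)))) (F band₃ lastPos)
  ∑-layout F F∅≡0 = trans (cong (λ m → ∑ m (λ d → F (layout d) d)) n≡)
    (cong (λ x → F bandTop 0 + (F band₂ 1 + x))
      (trans (∑-⟨⟩-zero g _ (λ _ → ∅) lowerBlock (λ δ d → F δ (suc (suc d))) (λ d → F∅≡0 _))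
        (∑-lowerBlock (λ δ d → F δ (suc (suc (d ℕ.+ g)))) (λ d → F∅≡0 _))))
    where
    n≡ : n ≡ suc (suc (g ℕ.+ (p ℕ.+ p ℕ.+ suc (suc (p ℕ.+ p ℕ.+ (g ℕ.+ 1))))))
    n≡ = arith g p
      where
      arith : ∀ g p → let h = g ℕ.+ (p ℕ.+ p) ℕ.+ 2 in
        suc (h ℕ.+ h) ≡ suc (suc (g ℕ.+ (p ℕ.+ p ℕ.+ suc (suc (p ℕ.+ p ℕ.+ (g ℕ.+ 1))))))
      arith = ℕ-Solver.solve-∀

  ∑-layout-pairs : ∀ (F : Diagonal → ℕ → ℤ) L U → (∀ d → F ∅ d ≡ + 0) →
    (∀ q → q < p → F (band₅ q) (lowerPos q) + F (band₆ q) (suc (lowerPos q)) ≡ L) →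
    (∀ q → q < p → F (band₄ q) (upperPos q) + F (band₇ q) (suc (upperPos q)) ≡ U) →
    ∑ n (λ d → F (layout d) d) ≡
      lineTotal (F bandTop 0) (F band₂ 1) (P * L) (F band₁ midPos) (F band₀ (suc midPos)) (P * U) (F band₃ lastPos)
  ∑-layout-pairs F L U F∅≡0 lower≡L upper≡U = trans (∑-layout F F∅≡0)
    (cong₂ (λ x y → lineTotal (F bandTop 0) (F band₂ 1) x (F band₁ midPos) (F band₀ (suc midPos)) y (F band₃ lastPos))
      (trans (∑-cong p lower≡L) (∑-const p L)) (trans (∑-cong p upper≡U) (∑-const p U)))

  filled-count : ∀ (r : ℕ → ℕ) → ∑ n (λ d → filledIndicator (layout d (r d))) ≡ + k
  filled-count r = trans
    (∑-layout-pairs (λ δ d → filledIndicator (δ (r d))) (+ 2) (+ 2) (λ _ → refl) (λ _ _ → refl) (λ _ _ → refl))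
    (trans (arith P) (sym +k≡5+4P))
    where
    arith : ∀ P → + 1 + (+ 1 + (P * + 2 + (+ 1 + (+ 1 + (P * + 2 + + 1))))) ≡ + 5 + + 4 * P
    arith = solve-∀

  ∑-row : ∀ i → ∑ n (λ d → cellVal (layout d i)) ≡ weight i + (+ 6 + + 4 * P) * N
  ∑-row i = trans (∑-layout-pairs (λ δ _ → cellVal (δ i)) (N + C - I) (+ 3 * N + I - C) (λ _ → refl)
                    (λ q _ → lower (+ q) N I C) (λ q _ → upper (+ q) N I C))
              (arith I (weight i) (+ (i ⊕ suc h)) (+ (i ⊕ h)) C P H)
    where
    I C : ℤ
    I = + i
    C = + (i ⊕ (n ∸ 1))
    lower : ∀ Q N I C → (C - (+ 6 + + 4 * Q) * N) + ((+ 7 + + 4 * Q) * N - I) ≡ N + C - I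
    lower = solve-∀
    upper : ∀ Q N I C → - ((+ 4 + + 4 * Q) * N + + 1 + C) + ((+ 7 + + 4 * Q) * N + + 1 + I) ≡ + 3 * N + I - C
    upper = solve-∀
    arith : ∀ I W A B C P H → let N = + 2 * H + + 1 in
      (I + I + W) + ((+ 2 * N + + 1 + A) + (P * (N + C - I) + (- (H + + 2 + I + B) +
        ((+ 3 * H + + 1 - (I + A)) + (P * (+ 3 * N + I - C) + (+ 3 * N + + 1 + B))))))
      ≡ W + (+ 6 + + 4 * P) * N
    arith = solve-∀

  j⊖0≡j : ∀ j → j < n → j ⊖ 0 ≡ j
  j⊖0≡j j j<n = trans (⊖≡⊕ j 0 n refl) (trans (⊕-+n j 0) (⊕-identityʳ j j<n))

  bandTop-column : ∀ j → j < n → cellVal (bandTop (j ⊖ 0)) ≡ + j + + j + weight j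
  bandTop-column j j<n = cong (λ i → + i + + i + weight i) (j⊖0≡j j j<n)

  band₂-column : ∀ j → cellVal (band₂ (j ⊖ 1)) ≡ + 2 * N + + 1 + + (j ⊕ h)
  band₂-column j = cong (λ x → + 2 * N + + 1 + + x)
    (trans (cong (_⊕ suc h) (⊖≡⊕ j 1 (h ℕ.+ h) refl)) (⊕-⊕-wrap j (h ℕ.+ h) (suc h) h (arith h)))
    where
    arith : ∀ h → h ℕ.+ h ℕ.+ suc h ≡ h ℕ.+ suc (h ℕ.+ h)
    arith = ℕ-Solver.solve-∀

  band₁-column : ∀ j → j < n → cellVal (band₁ (j ⊖ midPos)) ≡ - (H + + 2 + + (j ⊕ suc h) + + j)
  band₁-column j j<n = cong₂ (λ x y → - (H + + 2 + + x + + y)) j⊖mid≡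
    (trans (cong (_⊕ h) j⊖mid≡) (trans (⊕-⊕-wrap j (suc h) h 0 (arith h)) (⊕-identityʳ j j<n)))
    where
    j⊖mid≡ : j ⊖ midPos ≡ j ⊕ suc h
    j⊖mid≡ = ⊖≡⊕ j midPos (suc h) midPos+h+1≡n
    arith : ∀ h → suc h ℕ.+ h ≡ 0 ℕ.+ suc (h ℕ.+ h)
    arith = ℕ-Solver.solve-∀

  band₀-column : ∀ j → j < n → cellVal (band₀ (j ⊖ suc midPos)) ≡ + 3 * H + + 1 - (+ (j ⊕ h) + + j)
  band₀-column j j<n = cong₂ (λ x y → + 3 * H + + 1 - (+ x + + y)) j⊖mid+1≡
    (trans (cong (_⊕ suc h) j⊖mid+1≡) (trans (⊕-⊕-wrap j h (suc h) 0 (arith h)) (⊕-identityʳ j j<n)))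
    where
    j⊖mid+1≡ : j ⊖ suc midPos ≡ j ⊕ h
    j⊖mid+1≡ = ⊖≡⊕ j (suc midPos) h midPos+1+h≡n
    arith : ∀ h → h ℕ.+ suc h ≡ 0 ℕ.+ suc (h ℕ.+ h)
    arith = ℕ-Solver.solve-∀

  band₃-column : ∀ j → cellVal (band₃ (j ⊖ lastPos)) ≡ + 3 * N + + 1 + + (j ⊕ suc h)
  band₃-column j = cong (λ x → + 3 * N + + 1 + + x) (trans (cong (_⊕ h) (⊖≡⊕ j lastPos 1 lastPos+1≡n)) (⊕-assoc j 1 h))

  lowerPair-column : ∀ j q → q < p → cellVal (band₅ q (j ⊖ lowerPos q)) + cellVal (band₆ q (j ⊖ suc (lowerPos q))) ≡ N
  lowerPair-column j q q<p = trans
    (cong (λ x → (+ x - (+ 6 + + 4 * + q) * N) + ((+ 7 + + 4 * + q) * N - + (j ⊖ suc (lowerPos q))))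
      (⊖-suc j (lowerPos q) (ℕ.<⇒≤ (lowerPos-bound q q<p))))
    (arith (+ q) N (+ (j ⊖ suc (lowerPos q))))
    where
    arith : ∀ Q N X → (X - (+ 6 + + 4 * Q) * N) + ((+ 7 + + 4 * Q) * N - X) ≡ N
    arith = solve-∀

  upperPair-column : ∀ j q → q < p → cellVal (band₄ q (j ⊖ upperPos q)) + cellVal (band₇ q (j ⊖ suc (upperPos q))) ≡ + 3 * N
  upperPair-column j q q<p = trans
    (cong (λ x → - ((+ 4 + + 4 * + q) * N + + 1 + + x) + ((+ 7 + + 4 * + q) * N + + 1 + + (j ⊖ suc (upperPos q))))
      (⊖-suc j (upperPos q) (ℕ.<⇒≤ (upperPos-bound q q<p))))
    (arith (+ q) N (+ (j ⊖ suc (upperPos q))))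
    where
    arith : ∀ Q N X → - ((+ 4 + + 4 * Q) * N + + 1 + X) + ((+ 7 + + 4 * Q) * N + + 1 + X) ≡ + 3 * N
    arith = solve-∀

  ∑-column : ∀ j → j < n → ∑ n (λ d → cellVal (layout d (j ⊖ d))) ≡ weight j + (+ 6 + + 4 * P) * N
  ∑-column j j<n = begin
    ∑ n (λ d → cellVal (layout d (j ⊖ d)))
      ≡⟨ ∑-layout-pairs (λ δ d → cellVal (δ (j ⊖ d))) N (+ 3 * N) (λ _ → refl) (lowerPair-column j) (upperPair-column j) ⟩
    lineTotal (cellVal (bandTop (j ⊖ 0))) (cellVal (band₂ (j ⊖ 1))) (P * N) (cellVal (band₁ (j ⊖ midPos)))
      (cellVal (band₀ (j ⊖ suc midPos))) (P * (+ 3 * N)) (cellVal (band₃ (j ⊖ lastPos)))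
      ≡⟨ lineTotal-cong (P * N) (P * (+ 3 * N)) (bandTop-column j j<n) (band₂-column j) (band₁-column j j<n)
           (band₀-column j j<n) (band₃-column j) ⟩
    lineTotal (+ j + + j + weight j) (+ 2 * N + + 1 + + (j ⊕ h)) (P * N) (- (H + + 2 + + (j ⊕ suc h) + + j))
      (+ 3 * H + + 1 - (+ (j ⊕ h) + + j)) (P * (+ 3 * N)) (+ 3 * N + + 1 + + (j ⊕ suc h))
      ≡⟨ arith (+ j) (weight j) (+ (j ⊕ h)) (+ (j ⊕ suc h)) P H ⟩
    weight j + (+ 6 + + 4 * P) * N
      ∎
    where
    open ≡-Reasoning
    arith : ∀ J W A B P H → let N = + 2 * H + + 1 in
      (J + J + W) + ((+ 2 * N + + 1 + A) + (P * N + (- (H + + 2 + B + J) +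
        ((+ 3 * H + + 1 - (A + J)) + (P * (+ 3 * N) + (+ 3 * N + + 1 + B))))))
      ≡ W + (+ 6 + + 4 * P) * N
    arith = solve-∀

  weight-balances : ∀ i → + (2 ℕ.* n ℕ.* k ℕ.+ 1) ℤ.∣ weight i + (+ 6 + + 4 * P) * N
  weight-balances i with i ℕ.≤? h
  ... | yes _ = subst (+ (2 ℕ.* n ℕ.* k ℕ.+ 1) ℤ.∣_) (trans +2nk+1≡ (sym (arith P N))) ∣-refl
    where
    arith : ∀ P N → (+ 4 + + 4 * P) * N + + 1 + (+ 6 + + 4 * P) * N ≡ (+ 10 + + 8 * P) * N + + 1
    arith = solve-∀
  ... | no  _ = subst (+ (2 ℕ.* n ℕ.* k ℕ.+ 1) ℤ.∣_) (sym (ℤ.+-inverseˡ ((+ 6 + + 4 * P) * N))) (_ ∣0)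

  Covers : Diagonal → ℤ → Set
  Covers δ B = ∀ r → r < n → Σ ℕ λ i → i < n × δ i ≡± + 1 + (+ r + B * N)

  weight-≤ : ∀ {i} → i ≤ h → weight i ≡ (+ 4 + + 4 * P) * N + + 1
  weight-≤ {i} i≤h with i ℕ.≤? h
  ... | yes _   = refl
  ... | no i≰h = contradiction i≤h i≰h

  weight-> : ∀ {i} → h < i → weight i ≡ - ((+ 6 + + 4 * P) * N)
  weight-> {i} h<i with i ℕ.≤? h
  ... | yes i≤h = contradiction i≤h (ℕ.<⇒≱ h<i)
  ... | no _    = refl

  band₀-covers : Covers band₀ (+ 0)
  band₀-covers r r<n with even-or-odd r
  ... | s , inj₁ refl = h ℕ.+ e , s≤s (ℕ.+-monoʳ-≤ h (ℕ.m∸n≤m h s)) , inj₁ (cong just value)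
    where
    e = h ∸ s
    s≤h : s ≤ h
    s≤h = half-≤ (ℕ.≤-pred r<n)
    i⊕h+1≡e : h ℕ.+ e ⊕ suc h ≡ e
    i⊕h+1≡e = ⊕-wrap (h ℕ.+ e) (suc h) e (arith h e) (ℕ.≤-<-trans (ℕ.m∸n≤m h s) h<n)
      where
      arith : ∀ h e → h ℕ.+ e ℕ.+ suc h ≡ e ℕ.+ suc (h ℕ.+ h)
      arith = ℕ-Solver.solve-∀
    value : + 3 * H + + 1 - (+ (h ℕ.+ e) + + (h ℕ.+ e ⊕ suc h)) ≡ + 1 + (+ (s ℕ.+ s) + + 0 * N)
    value = begin
      + 3 * H + + 1 - (+ (h ℕ.+ e) + + (h ℕ.+ e ⊕ suc h))  ≡⟨ cong (λ x → + 3 * H + + 1 - (H + + e + + x)) i⊕h+1≡e ⟩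
      + 3 * H + + 1 - (H + + e + + e)                       ≡⟨ cong (λ x → + 3 * H + + 1 - (H + x + x)) (pos-∸ s≤h) ⟩
      + 3 * H + + 1 - (H + (H - + s) + (H - + s))           ≡⟨ arith H (+ s) ⟩
      + 1 + (+ s + + s + + 0 * N)                          ∎
      where
      open ≡-Reasoning
      arith : ∀ H S → + 3 * H + + 1 - (H + (H - S) + (H - S)) ≡ + 1 + (S + S + + 0 * (+ 2 * H + + 1))
      arith = solve-∀
  ... | s , inj₂ refl = e , ℕ.<-trans e<h h<n , inj₁ (cong just value)
    where
    e = h ∸ suc s
    s<h : s < h
    s<h = half-< (ℕ.≤-pred r<n)
    e<h : e < h
    e<h = ℕ.∸-monoʳ-< (s≤s z≤n) s<h
    i⊕h+1≡ : e ⊕ suc h ≡ e ℕ.+ suc h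
    i⊕h+1≡ = m<n⇒m%n≡m (s≤s (subst (_≤ h ℕ.+ h) (sym (ℕ.+-suc e h)) (ℕ.+-monoˡ-≤ h e<h)))
    value : + 3 * H + + 1 - (+ e + + (e ⊕ suc h)) ≡ + 1 + (+ suc (s ℕ.+ s) + + 0 * N)
    value = begin
      + 3 * H + + 1 - (+ e + + (e ⊕ suc h))                  ≡⟨ cong (λ x → + 3 * H + + 1 - (+ e + + x)) i⊕h+1≡ ⟩
      + 3 * H + + 1 - (+ e + (+ e + + suc h))                ≡⟨ cong (λ x → + 3 * H + + 1 - (x + (x + + suc h))) (pos-∸ s<h) ⟩
      + 3 * H + + 1 - ((H - + suc s) + ((H - + suc s) + + suc h)) ≡⟨ arith H (+ s) ⟩
      + 1 + (+ suc (s ℕ.+ s) + + 0 * N)                      ∎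
      where
      open ≡-Reasoning
      arith : ∀ H S → + 3 * H + + 1 - ((H - (+ 1 + S)) + ((H - (+ 1 + S)) + (+ 1 + H))) ≡ + 1 + ((+ 1 + (S + S)) + + 0 * (+ 2 * H + + 1))
      arith = solve-∀

  band₁-covers : Covers band₁ (+ 1)
  band₁-covers r r<n with even-or-odd r
  ... | s , inj₁ refl = s , ℕ.≤-<-trans s≤h h<n , inj₂ (cong (λ x → just (- x)) value)
    where
    s≤h : s ≤ h
    s≤h = half-≤ (ℕ.≤-pred r<n)
    value : H + + 2 + + s + + (s ⊕ h) ≡ + 1 + (+ (s ℕ.+ s) + + 1 * N)
    value = begin
      H + + 2 + + s + + (s ⊕ h)      ≡⟨ cong (λ x → H + + 2 + + s + + x) (m<n⇒m%n≡m (s≤s (ℕ.+-monoˡ-≤ h s≤h))) ⟩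
      H + + 2 + + s + (+ s + H)      ≡⟨ arith H (+ s) ⟩
      + 1 + ((+ s + + s) + + 1 * N)  ∎
      where
      open ≡-Reasoning
      arith : ∀ H S → H + + 2 + S + (S + H) ≡ + 1 + ((S + S) + + 1 * (+ 2 * H + + 1))
      arith = solve-∀
  ... | s , inj₂ refl = h ℕ.+ suc s , s≤s (ℕ.+-monoʳ-≤ h s<h) , inj₂ (cong (λ x → just (- x)) value)
    where
    s<h : s < h
    s<h = half-< (ℕ.≤-pred r<n)
    i⊕h≡s : h ℕ.+ suc s ⊕ h ≡ s
    i⊕h≡s = ⊕-wrap (h ℕ.+ suc s) h s (arith h s) (ℕ.<-trans s<h h<n)
      where
      arith : ∀ h s → h ℕ.+ suc s ℕ.+ h ≡ s ℕ.+ suc (h ℕ.+ h)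
      arith = ℕ-Solver.solve-∀
    value : H + + 2 + + (h ℕ.+ suc s) + + (h ℕ.+ suc s ⊕ h) ≡ + 1 + (+ suc (s ℕ.+ s) + + 1 * N)
    value = begin
      H + + 2 + + (h ℕ.+ suc s) + + (h ℕ.+ suc s ⊕ h)  ≡⟨ cong (λ x → H + + 2 + + (h ℕ.+ suc s) + + x) i⊕h≡s ⟩
      H + + 2 + (H + (+ 1 + + s)) + + s                ≡⟨ arith H (+ s) ⟩
      + 1 + ((+ 1 + (+ s + + s)) + + 1 * N)            ∎
      where
      open ≡-Reasoning
      arith : ∀ H S → H + + 2 + (H + (+ 1 + S)) + S ≡ + 1 + ((+ 1 + (S + S)) + + 1 * (+ 2 * H + + 1))
      arith = solve-∀

  band₂-covers : Covers band₂ (+ 2)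
  band₂-covers r r<n with ⊕-surjective (suc h) (s≤s (ℕ.m≤n+m h h)) r r<n
  ... | i , i<n , i⊕h+1≡r = i , i<n , inj₁ (cong just
    (trans (cong (λ x → + 2 * N + + 1 + + x) i⊕h+1≡r) (arith N (+ r))))
    where
    arith : ∀ N R → + 2 * N + + 1 + R ≡ + 1 + (R + + 2 * N)
    arith = solve-∀

  band₃-covers : Covers band₃ (+ 3)
  band₃-covers r r<n with ⊕-surjective h (ℕ.<⇒≤ h<n) r r<n
  ... | i , i<n , i⊕h≡r = i , i<n , inj₁ (cong just
    (trans (cong (λ x → + 3 * N + + 1 + + x) i⊕h≡r) (arith N (+ r))))
    where
    arith : ∀ N R → + 3 * N + + 1 + R ≡ + 1 + (R + + 3 * N)
    arith = solve-∀

  band₄-covers : ∀ q → Covers (band₄ q) (+ 4 + (+ 4 * + q + + 0))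
  band₄-covers q r r<n with ⊕-surjective (n ∸ 1) (ℕ.n≤1+n _) r r<n
  ... | i , i<n , i⊕2h≡r = i , i<n , inj₂ (cong (λ x → just (- x))
    (trans (cong (λ x → (+ 4 + + 4 * + q) * N + + 1 + + x) i⊕2h≡r) (arith (+ q) N (+ r))))
    where
    arith : ∀ Q N R → (+ 4 + + 4 * Q) * N + + 1 + R ≡ + 1 + (R + (+ 4 + (+ 4 * Q + + 0)) * N)
    arith = solve-∀

  band₅-covers : ∀ q → Covers (band₅ q) (+ 4 + (+ 4 * + q + + 1))
  band₅-covers q r r<n with ⊕-surjective (n ∸ 1) (ℕ.n≤1+n _) (n ∸ 1 ∸ r) (s≤s (ℕ.m∸n≤m _ r))
  ... | i , i<n , i⊕2h≡2h-r = i , i<n , inj₂ (cong just (begin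
    + (i ⊕ (n ∸ 1)) - (+ 6 + + 4 * + q) * N      ≡⟨ cong (λ x → + x - (+ 6 + + 4 * + q) * N) i⊕2h≡2h-r ⟩
    + (n ∸ 1 ∸ r) - (+ 6 + + 4 * + q) * N         ≡⟨ cong (λ x → x - (+ 6 + + 4 * + q) * N) (pos-∸ (ℕ.≤-pred r<n)) ⟩
    (H + H - + r) - (+ 6 + + 4 * + q) * N         ≡⟨ arith H (+ q) (+ r) ⟩
    - (+ 1 + (+ r + (+ 4 + (+ 4 * + q + + 1)) * N)) ∎))
    where
    open ≡-Reasoning
    arith : ∀ H Q R → (H + H - R) - (+ 6 + + 4 * Q) * (+ 2 * H + + 1) ≡ - (+ 1 + (R + (+ 4 + (+ 4 * Q + + 1)) * (+ 2 * H + + 1)))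
    arith = solve-∀

  band₆-covers : ∀ q → Covers (band₆ q) (+ 4 + (+ 4 * + q + + 2))
  band₆-covers q r r<n = n ∸ 1 ∸ r , s≤s (ℕ.m∸n≤m _ r) , inj₁ (cong just (begin
    (+ 7 + + 4 * + q) * N - + (n ∸ 1 ∸ r)         ≡⟨ cong (λ x → (+ 7 + + 4 * + q) * N - x) (pos-∸ (ℕ.≤-pred r<n)) ⟩
    (+ 7 + + 4 * + q) * N - (H + H - + r)         ≡⟨ arith H (+ q) (+ r) ⟩
    + 1 + (+ r + (+ 4 + (+ 4 * + q + + 2)) * N)    ∎))
    where
    open ≡-Reasoning
    arith : ∀ H Q R → (+ 7 + + 4 * Q) * (+ 2 * H + + 1) - (H + H - R) ≡ + 1 + (R + (+ 4 + (+ 4 * Q + + 2)) * (+ 2 * H + + 1))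
    arith = solve-∀

  band₇-covers : ∀ q → Covers (band₇ q) (+ 4 + (+ 4 * + q + + 3))
  band₇-covers q r r<n = r , r<n , inj₁ (cong just (arith (+ q) N (+ r)))
    where
    arith : ∀ Q N R → (+ 7 + + 4 * Q) * N + + 1 + R ≡ + 1 + (R + (+ 4 + (+ 4 * Q + + 3)) * N)
    arith = solve-∀

  bandTop-covers : Covers bandTop (+ 4 + + 4 * P)
  bandTop-covers r r<n with even-or-odd r
  ... | s , inj₁ refl = s , ℕ.≤-<-trans s≤h h<n , inj₁ (cong just (begin
    + s + + s + weight s                          ≡⟨ cong (λ x → + s + + s + x) (weight-≤ s≤h) ⟩
    + s + + s + ((+ 4 + + 4 * P) * N + + 1)       ≡⟨ arith (+ s) P N ⟩
    + 1 + (+ (s ℕ.+ s) + (+ 4 + + 4 * P) * N)     ∎))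
    where
    open ≡-Reasoning
    s≤h : s ≤ h
    s≤h = half-≤ (ℕ.≤-pred r<n)
    arith : ∀ S P N → S + S + ((+ 4 + + 4 * P) * N + + 1) ≡ + 1 + ((S + S) + (+ 4 + + 4 * P) * N)
    arith = solve-∀
  ... | s , inj₂ refl = h ℕ.+ h ∸ s , s≤s (ℕ.m∸n≤m _ s) , inj₂ (cong (λ x → just x) (begin
    + i + + i + weight i                           ≡⟨ cong (λ x → + i + + i + x) (weight-> h<i) ⟩
    + i + + i - (+ 6 + + 4 * P) * N                ≡⟨ cong (λ x → x + x - (+ 6 + + 4 * P) * N) (pos-∸ s≤h+h) ⟩
    (H + H - + s) + (H + H - + s) - (+ 6 + + 4 * P) * N ≡⟨ arith H (+ s) P ⟩
    - (+ 1 + (+ suc (s ℕ.+ s) + (+ 4 + + 4 * P) * N)) ∎))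
    where
    open ≡-Reasoning
    i = h ℕ.+ h ∸ s
    s<h : s < h
    s<h = half-< (ℕ.≤-pred r<n)
    s≤h+h : s ≤ h ℕ.+ h
    s≤h+h = ℕ.≤-trans (ℕ.<⇒≤ s<h) (ℕ.m≤m+n h h)
    h<i : h < i
    h<i = subst (h <_) (sym (ℕ.+-∸-assoc h (ℕ.<⇒≤ s<h))) (ℕ.m<m+n h (ℕ.m<n⇒0<n∸m s<h))
    arith : ∀ H S P → let N = + 2 * H + + 1 in
      (H + H - S) + (H + H - S) - (+ 6 + + 4 * P) * N ≡ - (+ 1 + ((+ 1 + (S + S)) + (+ 4 + + 4 * P) * N))
    arith = solve-∀

  data BandIndex : ℕ → Set where
    low : ∀ s → s < 4 → BandIndex s
    mid : ∀ q s → q < p → s < 4 → BandIndex (4 ℕ.+ (4 ℕ.* q ℕ.+ s))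
    top : BandIndex (4 ℕ.+ 4 ℕ.* p)

  bandIndex : ∀ b → b < k → BandIndex b
  bandIndex 0 _ = low 0 (s≤s z≤n)
  bandIndex 1 _ = low 1 (s≤s (s≤s z≤n))
  bandIndex 2 _ = low 2 (s≤s (s≤s (s≤s z≤n)))
  bandIndex 3 _ = low 3 (s≤s (s≤s (s≤s (s≤s z≤n))))
  bandIndex (suc (suc (suc (suc b)))) (s≤s (s≤s (s≤s (s≤s (s≤s b≤4p))))) with b / 4 ℕ.<? p
  ... | yes b/4<p = subst (BandIndex ∘ (4 ℕ.+_)) b≡ (mid (b / 4) (b % 4) b/4<p (m%n<n b 4))
    where
    b≡ : 4 ℕ.* (b / 4) ℕ.+ b % 4 ≡ b
    b≡ = trans (ℕ.+-comm (4 ℕ.* (b / 4)) (b % 4)) (trans (cong (b % 4 ℕ.+_) (ℕ.*-comm 4 (b / 4))) (sym (m≡m%n+[m/n]*n b 4)))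
  ... | no b/4≮p = subst (BandIndex ∘ (4 ℕ.+_)) (ℕ.≤-antisym 4p≤b b≤4p) top
    where
    4p≤b : 4 ℕ.* p ≤ b
    4p≤b = ℕ.≤-trans (ℕ.*-monoʳ-≤ 4 (ℕ.≮⇒≥ b/4≮p)) (subst (_≤ b) (ℕ.*-comm (b / 4) 4) (m/n*n≤m b 4))

  layout-lowerPos : ∀ q → q < p → layout (lowerPos q) ≡ band₅ q
  layout-lowerPos q q<p = trans (⟨⟩-lookupʳ g (λ _ → ∅) lowerBlock (q ℕ.+ q))
    (trans (⟨⟩-lookupˡ (p ℕ.+ p) (interleave band₅ band₆) midBlock (ℕ.+-mono-< q<p q<p)) (interleave-even band₅ band₆ q))

  layout-lowerPos+1 : ∀ q → q < p → layout (suc (lowerPos q)) ≡ band₆ q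
  layout-lowerPos+1 q q<p = trans (⟨⟩-lookupʳ g (λ _ → ∅) lowerBlock (suc (q ℕ.+ q)))
    (trans (⟨⟩-lookupˡ (p ℕ.+ p) (interleave band₅ band₆) midBlock (ℕ.+-mono-≤-< q<p q<p)) (interleave-odd band₅ band₆ q))

  layout-upperPos : ∀ q → q < p → layout (upperPos q) ≡ band₄ q
  layout-upperPos q q<p = trans (⟨⟩-lookupʳ g (λ _ → ∅) lowerBlock _)
    (trans (⟨⟩-lookupʳ (p ℕ.+ p) (interleave band₅ band₆) midBlock (suc (suc (q ℕ.+ q))))
      (trans (⟨⟩-lookupˡ (p ℕ.+ p) (interleave band₄ band₇) tailBlock (ℕ.+-mono-< q<p q<p)) (interleave-even band₄ band₇ q)))

  layout-upperPos+1 : ∀ q → q < p → layout (suc (upperPos q)) ≡ band₇ q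
  layout-upperPos+1 q q<p = trans (⟨⟩-lookupʳ g (λ _ → ∅) lowerBlock _)
    (trans (⟨⟩-lookupʳ (p ℕ.+ p) (interleave band₅ band₆) midBlock (suc (suc (suc (q ℕ.+ q)))))
      (trans (⟨⟩-lookupˡ (p ℕ.+ p) (interleave band₄ band₇) tailBlock (ℕ.+-mono-≤-< q<p q<p)) (interleave-odd band₄ band₇ q)))

  layout-midPos : layout midPos ≡ band₁
  layout-midPos = trans (⟨⟩-lookupʳ g (λ _ → ∅) lowerBlock (p ℕ.+ p))
    (⟨⟩-lookupʳ (p ℕ.+ p) (interleave band₅ band₆) midBlock 0)

  layout-midPos+1 : layout (suc midPos) ≡ band₀
  layout-midPos+1 = trans (⟨⟩-lookupʳ g (λ _ → ∅) lowerBlock (suc (p ℕ.+ p)))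
    (⟨⟩-lookupʳ (p ℕ.+ p) (interleave band₅ band₆) midBlock 1)

  layout-lastPos : layout lastPos ≡ band₃
  layout-lastPos = trans (⟨⟩-lookupʳ g (λ _ → ∅) lowerBlock _)
    (trans (⟨⟩-lookupʳ (p ℕ.+ p) (interleave band₅ band₆) midBlock _)
      (trans (⟨⟩-lookupʳ (p ℕ.+ p) (interleave band₄ band₇) tailBlock g) (⟨⟩-lookupʳ g (λ _ → ∅) (λ _ → band₃) 0)))

  +[4+4q+s]≡ : ∀ q s → + (4 ℕ.+ (4 ℕ.* q ℕ.+ s)) ≡ + 4 + (+ 4 * + q + + s)
  +[4+4q+s]≡ q s = cong (λ x → + 4 + (x + + s)) (ℤ.pos-* 4 q)

  layout-covers : ∀ {b} → BandIndex b → Σ ℕ λ d → d < n × Covers (layout d) (+ b)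
  layout-covers (low 0 _) = suc midPos , midPos+1<n , subst (λ δ → Covers δ (+ 0)) (sym layout-midPos+1) band₀-covers
  layout-covers (low 1 _) = midPos , ℕ.<-trans (ℕ.n<1+n midPos) midPos+1<n ,
                            subst (λ δ → Covers δ (+ 1)) (sym layout-midPos) band₁-covers
  layout-covers (low 2 _) = 1 , s≤s (ℕ.≤-trans 0<h (ℕ.m≤m+n h h)) , band₂-covers
  layout-covers (low 3 _) = lastPos , subst (lastPos <_) lastPos+1≡n (ℕ.m<m+n lastPos (s≤s z≤n)) ,
                            subst (λ δ → Covers δ (+ 3)) (sym layout-lastPos) band₃-covers
  layout-covers (low (suc (suc (suc (suc _)))) (s≤s (s≤s (s≤s (s≤s ())))))
  layout-covers (mid q 0 q<p _) = upperPos q , ℕ.<-trans (ℕ.n<1+n _) (upperPos-bound q q<p) ,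
    subst₂ Covers (sym (layout-upperPos q q<p)) (sym (+[4+4q+s]≡ q 0)) (band₄-covers q)
  layout-covers (mid q 1 q<p _) = lowerPos q , ℕ.<-trans (ℕ.n<1+n _) (lowerPos-bound q q<p) ,
    subst₂ Covers (sym (layout-lowerPos q q<p)) (sym (+[4+4q+s]≡ q 1)) (band₅-covers q)
  layout-covers (mid q 2 q<p _) = suc (lowerPos q) , lowerPos-bound q q<p ,
    subst₂ Covers (sym (layout-lowerPos+1 q q<p)) (sym (+[4+4q+s]≡ q 2)) (band₆-covers q)
  layout-covers (mid q 3 q<p _) = suc (upperPos q) , upperPos-bound q q<p ,
    subst₂ Covers (sym (layout-upperPos+1 q q<p)) (sym (+[4+4q+s]≡ q 3)) (band₇-covers q)
  layout-covers (mid q (suc (suc (suc (suc _)))) _ (s≤s (s≤s (s≤s (s≤s ())))))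
  layout-covers top = 0 , s≤s z≤n , subst (Covers bandTop) (cong (λ x → + 4 + x) (sym (ℤ.pos-* 4 p))) bandTop-covers

  covers : ∀ x → 1 ≤ x → x ≤ n ℕ.* k → Σ ℕ λ i → Σ ℕ λ d → i < n × d < n × layout d i ≡± + x
  covers (suc y) _ 1+y≤nk with layout-covers (bandIndex (y / n) (m<n*o⇒m/o<n (subst (y <_) (ℕ.*-comm n k) 1+y≤nk)))
  ... | d , d<n , covers-d with covers-d (y % n) (m%n<n y n)
  ... | i , i<n , v = i , d , i<n , d<n , subst (layout d i ≡±_) (cong (λ x → + 1 + x) (sym +y≡)) v
    where
    +y≡ : + y ≡ + (y % n) + + (y / n) * N
    +y≡ = trans (cong +_ (m≡m%n+[m/n]*n y n))
      (cong (λ x → + (y % n) + x) (trans (ℤ.pos-* (y / n) n) (cong (λ x → + (y / n) * x) +n≡N)))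

  heffterArray : HeffterArray n k
  heffterArray = array , isHeffter k filled-count
    (λ i _ → subst (+ (2 ℕ.* n ℕ.* k ℕ.+ 1) ℤ.∣_) (sym (∑-row i)) (weight-balances i))
    (λ j j<n → subst (+ (2 ℕ.* n ℕ.* k ℕ.+ 1) ℤ.∣_) (sym (∑-column j j<n)) (weight-balances j))
    covers
    where open DiagonalArray n layout

heffterArray-5+4p : ∀ g p → HeffterArray (5 ℕ.+ 4 ℕ.* p ℕ.+ 2 ℕ.* g) (5 ℕ.+ 4 ℕ.* p)
heffterArray-5+4p g p = subst (λ m → HeffterArray m (5 ℕ.+ 4 ℕ.* p)) (arith g p) (Construction.heffterArray g p)
  where
  arith : ∀ g p → let h = g ℕ.+ (p ℕ.+ p) ℕ.+ 2 in suc (h ℕ.+ h) ≡ 5 ℕ.+ 4 ℕ.* p ℕ.+ 2 ℕ.* g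
  arith = ℕ-Solver.solve-∀

m%4≡1⇒m≡1+[m/4]*4 : ∀ m → m % 4 ≡ 1 → m ≡ 1 ℕ.+ m / 4 ℕ.* 4
m%4≡1⇒m≡1+[m/4]*4 m m%4≡1 = trans (m≡m%n+[m/n]*n m 4) (cong (ℕ._+ m / 4 ℕ.* 4) m%4≡1)

1+4a≡5+4[c-1]+2[2[a-c]] : ∀ a c → 1 ≤ c → c ≤ a → 1 ℕ.+ a ℕ.* 4 ≡ 5 ℕ.+ 4 ℕ.* (c ∸ 1) ℕ.+ 2 ℕ.* (2 ℕ.* (a ∸ c))
1+4a≡5+4[c-1]+2[2[a-c]] a c 1≤c c≤a = begin
  1 ℕ.+ a ℕ.* 4                                     ≡⟨ cong (λ x → 1 ℕ.+ x ℕ.* 4) (sym (ℕ.m+[n∸m]≡n c≤a)) ⟩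
  1 ℕ.+ (c ℕ.+ (a ∸ c)) ℕ.* 4                       ≡⟨ cong (λ x → 1 ℕ.+ (x ℕ.+ (a ∸ c)) ℕ.* 4) (sym (ℕ.m+[n∸m]≡n 1≤c)) ⟩
  1 ℕ.+ (1 ℕ.+ (c ∸ 1) ℕ.+ (a ∸ c)) ℕ.* 4           ≡⟨ arith (c ∸ 1) (a ∸ c) ⟩
  5 ℕ.+ 4 ℕ.* (c ∸ 1) ℕ.+ 2 ℕ.* (2 ℕ.* (a ∸ c))     ∎
  where
  open ≡-Reasoning
  arith : ∀ c′ t → 1 ℕ.+ (1 ℕ.+ c′ ℕ.+ t) ℕ.* 4 ≡ 5 ℕ.+ 4 ℕ.* c′ ℕ.+ 2 ℕ.* (2 ℕ.* t)
  arith = ℕ-Solver.solve-∀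

theorem6p2 : (n k : ℕ) → n % 4 ≡ 1 → k % 4 ≡ 1 → 5 ≤ k → k < n →
    HeffterArray n k
theorem6p2 n k n%4≡1 k%4≡1 5≤k k<n =
  subst₂ HeffterArray (sym n≡) (sym k≡) (heffterArray-5+4p (2 ℕ.* (a ∸ c)) (c ∸ 1))
  where
  a = n / 4
  c = k / 4
  n≡1+4a : n ≡ 1 ℕ.+ a ℕ.* 4
  n≡1+4a = m%4≡1⇒m≡1+[m/4]*4 n n%4≡1
  k≡1+4c : k ≡ 1 ℕ.+ c ℕ.* 4
  k≡1+4c = m%4≡1⇒m≡1+[m/4]*4 k k%4≡1
  1≤c : 1 ≤ c
  1≤c = ℕ.*-cancelʳ-≤ 1 c 4 (ℕ.≤-pred (subst (5 ≤_) k≡1+4c 5≤k))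
  c≤a : c ≤ a
  c≤a = ℕ.<⇒≤ (ℕ.*-cancelʳ-< 4 c a (ℕ.+-cancelˡ-< 1 _ _ (subst₂ _<_ k≡1+4c n≡1+4a k<n)))
  n≡ : n ≡ 5 ℕ.+ 4 ℕ.* (c ∸ 1) ℕ.+ 2 ℕ.* (2 ℕ.* (a ∸ c))
  n≡ = trans n≡1+4a (1+4a≡5+4[c-1]+2[2[a-c]] a c 1≤c c≤a)
  k≡ : k ≡ 5 ℕ.+ 4 ℕ.* (c ∸ 1)
  k≡ = trans k≡1+4c (trans (1+4a≡5+4[c-1]+2[2[a-c]] c c 1≤c ℕ.≤-refl)
    (trans (cong (λ t → 5 ℕ.+ 4 ℕ.* (c ∸ 1) ℕ.+ 2 ℕ.* (2 ℕ.* t)) (ℕ.n∸n≡0 c)) (ℕ.+-identityʳ _)))
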